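{- Let $d$ be a positive integer, $F$ a Young diagram whose outer boundary is encoded by the type sequence $w$, and $T$ a $d$-semistandard $w$-oscillating tableau; let $A$ be the filling of $F$ of the unique $d$-RSK growth diagram on $F$ whose outer boundary carries $T$. Then: (1) for each $i$, the sum of the entries in the $i$th row of $A$ equals $\mathrm{wt}^+(T)_i$, and for each $j$, the sum of the entries in the $j$th column of $A$ equals $\mathrm{wt}^-(T)_j$; (2) the reversal of $T$, viewed as a $d$-semistandard $w'$-oscillating tableau, corresponds in the same way to the reflection of $A$ across the line $y=x$ (a filling of the reflected Young diagram $F'$). The same two properties hold with "$d$-RSK" replaced by "RSK" and "$d$-semistandard" by "semistandard".
   Context: Partitions: finite weakly decreasing sequences of positive integers, $\lambda_i=0$ beyond the length $\ell(\lambda)$, $|\lambda|=\sum\lambda_i$; $d$-partitions have $\ell(\lambda)\le d$; $\alpha\prec\beta$ (or $\beta\succ\alpha$) means $\beta_1\ge\alpha_1\ge\beta_2\ge\alpha_2\ge\cdots$. Young diagrams lie in the first quadrant, row $i$ counted from the bottom, column $j$ from the left, cells are unit squares with integer vertices (lattice points). The outer boundary is the lattice path from the positive $x$-axis to the positive $y$-axis along the boundary with unit steps up ($+$) or left ($-$); $w=w_1\cdots w_k$ records these steps in order. A semistandard $w$-oscillating tableau is a sequence of partitions $\emptyset=\lambda^{(0)},\ldots,\lambda^{(k)}=\emptyset$ with $\lambda^{(i-1)}\prec\lambda^{(i)}$ if $w_i=+$ and $\lambda^{(i-1)}\succ\lambda^{(i)}$ if $w_i=-$; it is $d$-semistandard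 if all $\lambda^{(i)}$ are $d$-partitions. $\mathrm{wt}^+(T)_i=|\lambda^{(a_i)}|-|\lambda^{(a_i-1)}|$ where $a_i$ is the index of the $i$th occurrence of $+$ in $w$; $\mathrm{wt}^-(T)_i=|\lambda^{(b_i-1)}|-|\lambda^{(b_i)}|$ where $b_i$ is the index of the $i$th-to-last occurrence of $-$ in $w$. The reversal of $T$ is $(\lambda^{(k)},\ldots,\lambda^{(0)})$, and $w'$ is obtained from $w$ by reversing it and swapping $+$ and $-$. A growth diagram on $F$: a filling of $F$ (nonnegative integer entries on cells) and a partition at each lattice point, $\emptyset$ at all lattice points on the axes, such that every cell with entry $m$ and corners $\kappa$ (bottom-left), $\mu$ (top-left), $\nu$ (bottom-right), $\rho$ (top-right) satisfies a local rule. RSK local rule: $\mu\succ\kappa\prec\nu$, $\mu\prec\rho\succ\nu$, $\rho_1=m+\max(\mu_1,\nu_1)$, $\rho_i+\kappa_{i-1}=\min(\mu_{i-1},\nu_{i-1})+\max(\mu_i,\nu_i)$ for $i\ge2$. $d$-RSK local rule: all four are $d$-partitions, $\mu\succ\kappa\prec\nu$, $\mu\prec\rho\succ\nu$, $m=0$ or $\kappa_d=0$, $\rho_1+\kappa_d=m+\min(\mu_d,\nu_d)+\max(\mu_1,\nu_1)$, $\rho_i+\kappa_{i-1}=\min(\mu_{i-1},\nu_{i-1})+\max(\mu_i,\nu_i)$ for $2\le i\le d$. It is known (proved in the paper) that each $d$-semistandard (resp. semistandard) $w$-oscillating tableau placed on the outer boundary of $F$ extends uniquely to a $d$-RSK (resp.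 RSK) growth diagram on $F$. -}

module Defs where

open import Data.Nat using (ℕ; zero; suc; _+_; _∸_; _≤_; _≤?_; _⊔_; _⊓_; pred)
open import Data.List using (List; []; _∷_; _++_; map; length; upTo; reverse; replicate; filter)
open import Data.Nat.ListAction using (sum)
open import Data.List.Relation.Unary.All using (All)
open import Data.List.Relation.Unary.Linked using (Linked)
open import Data.Product using (_×_; _,_)
open import Data.Sum using (_⊎_)
open import Data.Unit using (⊤)
open import Data.Empty using (⊥)
open import Relation.Binary.PropositionalEquality using (_≡_)

-- Partitions: represented as lists of positive integers, weakly
-- decreasing (no trailing zeros), so ∅ is the empty list [].

IsPartition : List ℕ → Set
IsPartition λ′ = Linked (λ a b → b ≤ a) λ′ × All (λ a → 1 ≤ a) λ′

-- 0-indexed access:  λ ! i  is the paper's  λ_{i+1}  (0 beyond the length)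
_!_ : List ℕ → ℕ → ℕ
[] ! _ = 0
(a ∷ _) ! zero = a
(_ ∷ l) ! suc i = l ! i

IsDPartition : ℕ → List ℕ → Set
IsDPartition d λ′ = IsPartition λ′ × length λ′ ≤ d

size : List ℕ → ℕ
size = sum

_≺_ : List ℕ → List ℕ → Set
α ≺ β = ∀ i → (α ! i ≤ β ! i) × (β ! suc i ≤ α ! i)

data Sign : Set where
  plus minus : Sign

Step : Sign → List ℕ → List ℕ → Set
Step plus  α β = α ≺ β
Step minus α β = β ≺ α

Steps : List Sign → List ℕ → List (List ℕ) → Set
Steps []      λ′ []      = λ′ ≡ []
Steps []      _  (_ ∷ _) = ⊥
Steps (_ ∷ _) _  []      = ⊥
Steps (s ∷ w) λ′ (μ ∷ T) = Step s λ′ μ × Steps w μ T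

Oscillating : List Sign → List (List ℕ) → Set
Oscillating w []       = ⊥
Oscillating w (λ′ ∷ T) = λ′ ≡ [] × Steps w λ′ T

Semistandard : List Sign → List (List ℕ) → Set
Semistandard w T = Oscillating w T × All IsPartition T

DSemistandard : ℕ → List Sign → List (List ℕ) → Set
DSemistandard d w T = Oscillating w T × All (IsDPartition d) T

wtPlus : List Sign → List (List ℕ) → List ℕ
wtPlus (plus  ∷ w) (λ′ ∷ μ ∷ T) = (size μ ∸ size λ′) ∷ wtPlus w (μ ∷ T)
wtPlus (minus ∷ w) (λ′ ∷ μ ∷ T) = wtPlus w (μ ∷ T)
wtPlus _ _ = []

wtMinusFwd : List Sign → List (List ℕ) → List ℕ
wtMinusFwd (plus  ∷ w) (λ′ ∷ μ ∷ T) = wtMinusFwd w (μ ∷ T)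
wtMinusFwd (minus ∷ w) (λ′ ∷ μ ∷ T) = (size λ′ ∸ size μ) ∷ wtMinusFwd w (μ ∷ T)
wtMinusFwd _ _ = []

-- wt⁻(T)_i uses the i-th-to-last occurrence of −
wtMinus : List Sign → List (List ℕ) → List ℕ
wtMinus w T = reverse (wtMinusFwd w T)

swap : Sign → Sign
swap plus = minus
swap minus = plus

dualWord : List Sign → List Sign
dualWord w = reverse (map swap w)

-- A Young diagram F is given by a partition: F ! (i-1)
-- is the length of row i (rows counted from the bottom, 1-indexed).
-- Cell (i , j) (row i, column j, both ≥ 1) is the unit square
-- [j-1, j] × [i-1, i].  Lattice points are written (x , y).

Cell : List ℕ → ℕ → ℕ → Set
Cell F i j = (1 ≤ i) × (1 ≤ j) × (j ≤ F ! (i ∸ 1))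

LatticePt : List ℕ → ℕ → ℕ → Set
LatticePt F x y = (y ≤ length F) × (x ≤ F ! pred y)

oneTo : ℕ → List ℕ
oneTo n = map suc (upTo n)

conj : List ℕ → List ℕ
conj F = map (λ j → length (filter (λ a → j ≤? a) F)) (oneTo (F ! 0))

-- outer boundary: from (F₁ , 0) up and left to (0 , ℓ(F)).
-- In row y (at height y-1 → y) we go up at x = a = F_y, then left to F_{y+1}.
head0 : List ℕ → ℕ
head0 [] = 0
head0 (a ∷ _) = a

boundaryFrom : ℕ → List ℕ → List (ℕ × ℕ)
boundaryFrom y [] = []
boundaryFrom y (a ∷ rest) =
  ((a , y) ∷ map (λ t → (a ∸ suc t , y)) (upTo (a ∸ head0 rest)))
  ++ boundaryFrom (suc y) rest

boundaryPoints : List ℕ → List (ℕ × ℕ)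
boundaryPoints F = (F ! 0 , 0) ∷ boundaryFrom 1 F

wordFrom : List ℕ → List Sign
wordFrom [] = []
wordFrom (a ∷ rest) = (plus ∷ replicate (a ∸ head0 rest) minus) ++ wordFrom rest

word : List ℕ → List Sign
word = wordFrom

-- Local rules.  Arguments: entry m, then κ (bottom-left), μ (top-left),
-- ν (bottom-right), ρ (top-right).

LocalRule : Set₁
LocalRule = ℕ → List ℕ → List ℕ → List ℕ → List ℕ → Set

RSKRule : LocalRule
RSKRule m κ μ ν ρ =
  IsPartition κ × IsPartition μ × IsPartition ν × IsPartition ρ ×
  κ ≺ μ × κ ≺ ν × μ ≺ ρ × ν ≺ ρ ×
  (ρ ! 0 ≡ m + (μ ! 0 ⊔ ν ! 0)) ×
  (∀ k → ρ ! suc k + κ ! k ≡ (μ ! k ⊓ ν ! k) + (μ ! suc k ⊔ ν ! suc k))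

dRSKRule : ℕ → LocalRule
dRSKRule d m κ μ ν ρ =
  IsDPartition d κ × IsDPartition d μ × IsDPartition d ν × IsDPartition d ρ ×
  κ ≺ μ × κ ≺ ν × μ ≺ ρ × ν ≺ ρ ×
  (m ≡ 0 ⊎ κ ! (d ∸ 1) ≡ 0) ×
  (ρ ! 0 + κ ! (d ∸ 1) ≡ m + (μ ! (d ∸ 1) ⊓ ν ! (d ∸ 1)) + (μ ! 0 ⊔ ν ! 0)) ×
  -- paper's i = k + 2, for 2 ≤ i ≤ d
  (∀ k → suc (suc k) ≤ d →
     ρ ! suc k + κ ! k ≡ (μ ! k ⊓ ν ! k) + (μ ! suc k ⊔ ν ! suc k))

-- A growth diagram on F: filling A (A i j = entry of cell (row i, column j))
-- and partitions P x y at lattice points (x , y).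
record IsGrowth (R : LocalRule) (F : List ℕ)
                (A : ℕ → ℕ → ℕ) (P : ℕ → ℕ → List ℕ) : Set where
  field
    partitionAt : ∀ x y → LatticePt F x y → IsPartition (P x y)
    emptyOnAxes : ∀ x y → LatticePt F x y → (x ≡ 0 ⊎ y ≡ 0) → P x y ≡ []
    local       : ∀ i j → Cell F i j →
                  R (A i j) (P (j ∸ 1) (i ∸ 1)) (P (j ∸ 1) i) (P j (i ∸ 1)) (P j i)

Carries : List ℕ → (ℕ → ℕ → List ℕ) → List (List ℕ) → Set
Carries F P T = map (λ p → P (Data.Product.proj₁ p) (Data.Product.proj₂ p)) (boundaryPoints F) ≡ T

rowSum : List ℕ → (ℕ → ℕ → ℕ) → ℕ → ℕ
rowSum F A i = sum (map (λ j → A i j) (oneTo (F ! (i ∸ 1))))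

colSum : List ℕ → (ℕ → ℕ → ℕ) → ℕ → ℕ
colSum F A j = sum (map (λ i → A i j) (filter (λ i → j ≤? F ! (i ∸ 1)) (oneTo (length F))))

rowSums : List ℕ → (ℕ → ℕ → ℕ) → List ℕ
rowSums F A = map (rowSum F A) (oneTo (length F))

colSums : List ℕ → (ℕ → ℕ → ℕ) → List ℕ
colSums F A = map (colSum F A) (oneTo (F ! 0))

reflectFilling : (ℕ → ℕ → ℕ) → (ℕ → ℕ → ℕ)
reflectFilling A i j = A j i

reflectPts : (ℕ → ℕ → List ℕ) → (ℕ → ℕ → List ℕ)
reflectPts P x y = P y x

Prop34Claim : LocalRule → (List Sign → List (List ℕ) → Set) → Set
Prop34Claim R Valid =
  ∀ (F : List ℕ) → IsPartition F →
  ∀ (T : List (List ℕ)) → Valid (word F) T →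
  ∀ (A : ℕ → ℕ → ℕ) (P : ℕ → ℕ → List ℕ) → IsGrowth R F A P → Carries F P T →
    ( rowSums F A ≡ wtPlus (word F) T
    × colSums F A ≡ wtMinus (word F) T )
    ×
    ( word (conj F) ≡ dualWord (word F)
    × Valid (dualWord (word F)) (reverse T)
    × IsGrowth R (conj F) (reflectFilling A) (reflectPts P)
    × Carries (conj F) (reflectPts P) (reverse T)
    × (∀ (A′ : ℕ → ℕ → ℕ) (P′ : ℕ → ℕ → List ℕ) →
         IsGrowth R (conj F) A′ P′ → Carries (conj F) P′ (reverse T) →
         ∀ i j → Cell (conj F) i j → A′ i j ≡ reflectFilling A i j) )

-- By the local rule, |ρ| + |κ| = m + |μ| + |ν| in every cell, so the sizes telescope along a
-- row: the i-th row sum is |λ| at the right end of the top edge of the row minus |λ| at the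
-- right end of its bottom edge, i.e. the size increase at the i-th up-step of the boundary.
-- Both rules are symmetric in μ and ν, so transposing a growth diagram on F gives one on the
-- conjugate F′; the boundary of F′ is the boundary of F traversed backwards and transposed,
-- hence it has type sequence w′ and carries the reversal of T. Column sums of A are row sums
-- of the transpose, i.e. wt⁺ of the reversal, which is wt⁻(T). Finally μ, ν and ρ determine m
-- and κ, so a filling is determined by its boundary, by induction from the outer corners inward.

module Submission where

open import Defs
open import Data.Nat using (ℕ; zero; suc; _+_; _∸_; _≤_; _<_; _≤?_; _⊔_; _⊓_; pred; _<?_; z≤n; s≤s; z<s; s<s; s<s⁻¹)
open import Data.Nat.Properties
open import Data.List using (List; []; _∷_; _++_; map; length; upTo; applyUpTo; reverse; replicate; filter; _∷ʳ_)
open import Data.List.Properties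
  using (map-++; map-∘; map-upTo; map-applyUpTo; length-map; length-applyUpTo; ++-assoc; ++-identityʳ; ∷ʳ-++;
         unfold-reverse; reverse-map; reverse-++; length-reverse; applyUpTo-∷ʳ; filter-accept; filter-reject; length-filter; filter-all;
         ∷-injectiveˡ; ∷-injectiveʳ)
open import Data.Nat.ListAction using (sum)
open import Data.Nat.ListAction.Properties using (sum-++)
open import Data.List.Relation.Unary.All using (All; []; _∷_)
open import Data.List.Relation.Unary.All.Properties using (++⁺)
open import Data.List.Relation.Unary.Linked using (Linked; _∷_)
open import Data.List.Relation.Unary.Any using (here; there)
open import Data.List.Membership.Propositional using (_∈_)
open import Data.List.Membership.Propositional.Properties using (∈-++⁺ˡ; ∈-++⁺ʳ; ∈-map⁺; ∈-upTo⁺)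
open import Data.Product using (_×_; _,_; proj₁; proj₂; Σ-syntax)
open import Data.Sum using (_⊎_; inj₁; inj₂)
open import Data.Unit using (⊤; tt)
open import Data.Empty using (⊥)
open import Relation.Nullary using (¬_; yes; no; contradiction)
open import Relation.Unary using (Pred; Decidable)
open import Relation.Binary.PropositionalEquality
open import Relation.Binary.Definitions using (tri<; tri≈; tri>)
open import Function using (_∘_)
open import Data.Nat.Tactic.RingSolver using (solve-∀)

applyUpTo-++ : ∀ {A : Set} (f : ℕ → A) m n → applyUpTo f (m + n) ≡ applyUpTo f m ++ applyUpTo (f ∘ (m +_)) n
applyUpTo-++ f zero    n = refl
applyUpTo-++ f (suc m) n = cong (f 0 ∷_) (applyUpTo-++ (f ∘ suc) m n)

applyUpTo-cong : ∀ {A : Set} {f g : ℕ → A} n → (∀ i → i < n → f i ≡ g i) → applyUpTo f n ≡ applyUpTo g n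
applyUpTo-cong zero    _  = refl
applyUpTo-cong (suc n) eq = cong₂ _∷_ (eq 0 z<s) (applyUpTo-cong n (λ i i<n → eq (suc i) (s<s i<n)))

applyUpTo-const : ∀ {A : Set} (c : A) n → applyUpTo (λ _ → c) n ≡ replicate n c
applyUpTo-const c zero    = refl
applyUpTo-const c (suc n) = cong (c ∷_) (applyUpTo-const c n)

applyUpTo-! : ∀ (f : ℕ → ℕ) n i → i < n → applyUpTo f n ! i ≡ f i
applyUpTo-! f (suc n) zero    _         = refl
applyUpTo-! f (suc n) (suc i) (s<s i<n) = applyUpTo-! (f ∘ suc) n i i<n

oneTo-applyUpTo : ∀ n → oneTo n ≡ applyUpTo suc n
oneTo-applyUpTo = map-upTo suc

map-oneTo : ∀ {A : Set} (f : ℕ → A) n → map f (oneTo n) ≡ applyUpTo (f ∘ suc) n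
map-oneTo f n = trans (cong (map f) (oneTo-applyUpTo n)) (map-applyUpTo suc f n)

length-oneTo : ∀ n → length (oneTo n) ≡ n
length-oneTo n = trans (cong length (oneTo-applyUpTo n)) (length-applyUpTo suc n)

replicate-∷ʳ : ∀ {A : Set} n (x : A) → replicate (suc n) x ≡ replicate n x ∷ʳ x
replicate-∷ʳ zero    x = refl
replicate-∷ʳ (suc n) x = cong (x ∷_) (replicate-∷ʳ n x)

!-0 : ∀ l → l ! 0 ≡ head0 l
!-0 []      = refl
!-0 (_ ∷ _) = refl

!-beyond-length : ∀ l k → length l ≤ k → l ! k ≡ 0
!-beyond-length []      k       _         = refl
!-beyond-length (_ ∷ l) (suc k) (s≤s l≤k) = !-beyond-length l k l≤k

!-positive⇒<length : ∀ l k → 1 ≤ l ! k → k < length l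
!-positive⇒<length (_ ∷ _) zero    _ = z<s
!-positive⇒<length (_ ∷ l) (suc k) p = s<s (!-positive⇒<length l k p)

!-≤-sum : ∀ l k → l ! k ≤ sum l
!-≤-sum []      k       = z≤n
!-≤-sum (a ∷ l) zero    = m≤m+n a (sum l)
!-≤-sum (a ∷ l) (suc k) = ≤-trans (!-≤-sum l k) (m≤n+m (sum l) a)

-- The positivity hypotheses are needed because _!_ pads with zeros.
!-extensionality : ∀ l l′ → All (1 ≤_) l → All (1 ≤_) l′ → (∀ k → l ! k ≡ l′ ! k) → l ≡ l′
!-extensionality []      []       _         _         _  = refl
!-extensionality []      (_ ∷ _)  _         (p′ ∷ _)  eq = contradiction (subst (1 ≤_) (sym (eq 0)) p′) λ ()
!-extensionality (_ ∷ _) []       (p ∷ _)   _         eq = contradiction (subst (1 ≤_) (eq 0) p) λ ()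
!-extensionality (_ ∷ l) (_ ∷ l′) (_ ∷ ps) (_ ∷ ps′) eq =
  cong₂ _∷_ (eq 0) (!-extensionality l l′ ps ps′ (eq ∘ suc))

sumBelow : (ℕ → ℕ) → ℕ → ℕ
sumBelow f zero    = 0
sumBelow f (suc n) = sumBelow f n + f n

sumBelow-front : ∀ f n → sumBelow f (suc n) ≡ f 0 + sumBelow (f ∘ suc) n
sumBelow-front f zero    = +-comm 0 (f 0)
sumBelow-front f (suc n) = trans (cong (_+ f (suc n)) (sumBelow-front f n)) (+-assoc (f 0) _ _)

sumBelow-cong : ∀ {f g} n → (∀ i → i < n → f i ≡ g i) → sumBelow f n ≡ sumBelow g n
sumBelow-cong zero    _  = refl
sumBelow-cong (suc n) eq = cong₂ _+_ (sumBelow-cong n (λ i i<n → eq i (m<n⇒m<1+n i<n))) (eq n ≤-refl)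

sumBelow-+ : ∀ f g n → sumBelow (λ i → f i + g i) n ≡ sumBelow f n + sumBelow g n
sumBelow-+ f g zero    = refl
sumBelow-+ f g (suc n) rewrite sumBelow-+ f g n = shuffle (sumBelow f n) (sumBelow g n) (f n) (g n)
  where
  shuffle : ∀ a b c d → a + b + (c + d) ≡ a + c + (b + d)
  shuffle = solve-∀

sumBelow-zero : ∀ n → sumBelow (λ _ → 0) n ≡ 0
sumBelow-zero zero    = refl
sumBelow-zero (suc n) = trans (+-identityʳ _) (sumBelow-zero n)

sum-sumBelow : ∀ l n → length l ≤ n → sum l ≡ sumBelow (l !_) n
sum-sumBelow []      n       _         = sym (sumBelow-zero n)
sum-sumBelow (a ∷ l) (suc n) (s≤s l≤n) =
  trans (cong (a +_) (sum-sumBelow l n l≤n)) (sym (sumBelow-front ((a ∷ l) !_) n))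

m⊓n+m⊔n≡m+n : ∀ m n → (m ⊓ n) + (m ⊔ n) ≡ m + n
m⊓n+m⊔n≡m+n zero    n       = refl
m⊓n+m⊔n≡m+n (suc m) zero    = sym (+-identityʳ (suc m))
m⊓n+m⊔n≡m+n (suc m) (suc n) =
  cong suc (trans (+-suc (m ⊓ n) (m ⊔ n)) (trans (cong suc (m⊓n+m⊔n≡m+n m n)) (sym (+-suc m n))))

-- Local rules

-- Everything the proof uses about a local rule.
record WellBehaved (R : LocalRule) : Set where
  field
    size-identity : ∀ {m κ μ ν ρ} → R m κ μ ν ρ → size ρ + size κ ≡ m + size μ + size ν
    transpose     : ∀ {m κ μ ν ρ} → R m κ μ ν ρ → R m κ ν μ ρ
    backward-unique : ∀ {m m′ κ κ′ μ ν ρ} → R m κ μ ν ρ → R m′ κ′ μ ν ρ → m ≡ m′ × κ ≡ κ′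

module LocalRuleSums (κ μ ν ρ : List ℕ) where

  lower upper : ℕ → ℕ
  lower k = μ ! k ⊓ ν ! k
  upper k = μ ! k ⊔ ν ! k

  RowEquationsBelow : ℕ → Set
  RowEquationsBelow n = ∀ k → k < n → ρ ! suc k + κ ! k ≡ lower k + upper (suc k)

  telescope : ∀ n → RowEquationsBelow n →
    sumBelow (ρ !_) (suc n) + sumBelow (κ !_) n ≡ ρ ! 0 + sumBelow lower n + sumBelow (upper ∘ suc) n
  telescope zero    _  = sym (+-identityʳ (ρ ! 0 + 0))
  telescope (suc n) eq = begin
      (sumBelow (ρ !_) (suc n) + ρ ! suc n) + (sumBelow (κ !_) n + κ ! n)
    ≡⟨ regroup (sumBelow (ρ !_) (suc n)) (sumBelow (κ !_) n) (ρ ! suc n) (κ ! n) ⟩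
      (sumBelow (ρ !_) (suc n) + sumBelow (κ !_) n) + (ρ ! suc n + κ ! n)
    ≡⟨ cong₂ _+_ (telescope n (λ k k<n → eq k (m<n⇒m<1+n k<n))) (eq n ≤-refl) ⟩
      (ρ ! 0 + sumBelow lower n + sumBelow (upper ∘ suc) n) + (lower n + upper (suc n))
    ≡⟨ regroup′ (ρ ! 0) _ _ _ _ ⟩
      ρ ! 0 + (sumBelow lower n + lower n) + (sumBelow (upper ∘ suc) n + upper (suc n))
    ∎
    where
    open ≡-Reasoning
    regroup : ∀ a b c d → (a + c) + (b + d) ≡ (a + b) + (c + d)
    regroup = solve-∀
    regroup′ : ∀ r a b c d → (r + a + b) + (c + d) ≡ r + (a + c) + (b + d)
    regroup′ = solve-∀

  lower+upper : ∀ n → length μ ≤ n → length ν ≤ n → sumBelow lower n + sumBelow upper n ≡ size μ + size ν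
  lower+upper n μ≤n ν≤n = begin
      sumBelow lower n + sumBelow upper n
    ≡⟨ sym (sumBelow-+ lower upper n) ⟩
      sumBelow (λ k → lower k + upper k) n
    ≡⟨ sumBelow-cong n (λ k _ → m⊓n+m⊔n≡m+n (μ ! k) (ν ! k)) ⟩
      sumBelow (λ k → μ ! k + ν ! k) n
    ≡⟨ sumBelow-+ (μ !_) (ν !_) n ⟩
      sumBelow (μ !_) n + sumBelow (ν !_) n
    ≡⟨ sym (cong₂ _+_ (sum-sumBelow μ n μ≤n) (sum-sumBelow ν n ν≤n)) ⟩
      size μ + size ν
    ∎
    where open ≡-Reasoning

rsk-size-identity : ∀ {m κ μ ν ρ} → RSKRule m κ μ ν ρ → size ρ + size κ ≡ m + size μ + size ν
rsk-size-identity {m} {κ} {μ} {ν} {ρ} (_ , _ , _ , _ , _ , _ , _ , _ , first , rest) = begin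
    size ρ + size κ
  ≡⟨ cong₂ _+_ (sum-sumBelow ρ (suc n) (m≤n⇒m≤1+n ρ≤n)) (sum-sumBelow κ n κ≤n) ⟩
    sumBelow (ρ !_) (suc n) + sumBelow (κ !_) n
  ≡⟨ telescope n (λ k _ → rest k) ⟩
    ρ ! 0 + sumBelow lower n + sumBelow (upper ∘ suc) n
  ≡⟨ cong (λ r → r + sumBelow lower n + sumBelow (upper ∘ suc) n) first ⟩
    m + upper 0 + sumBelow lower n + sumBelow (upper ∘ suc) n
  ≡⟨ regroup m (upper 0) (sumBelow lower n) (sumBelow (upper ∘ suc) n) ⟩
    m + (sumBelow lower n + (upper 0 + sumBelow (upper ∘ suc) n))
  ≡⟨ cong₂ (λ s t → m + (s + t)) lower-extend (sym (sumBelow-front upper n)) ⟩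
    m + (sumBelow lower (suc n) + sumBelow upper (suc n))
  ≡⟨ cong (m +_) (lower+upper (suc n) (m≤n⇒m≤1+n μ≤n) (m≤n⇒m≤1+n ν≤n)) ⟩
    m + (size μ + size ν)
  ≡⟨ sym (+-assoc m _ _) ⟩
    m + size μ + size ν
  ∎
  where
  open ≡-Reasoning
  open LocalRuleSums κ μ ν ρ
  n : ℕ
  n = (length κ ⊔ length μ) ⊔ (length ν ⊔ length ρ)
  κ≤n : length κ ≤ n
  κ≤n = ≤-trans (m≤m⊔n (length κ) (length μ)) (m≤m⊔n _ (length ν ⊔ length ρ))
  μ≤n : length μ ≤ n
  μ≤n = ≤-trans (m≤n⊔m (length κ) (length μ)) (m≤m⊔n _ (length ν ⊔ length ρ))
  ν≤n : length ν ≤ n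
  ν≤n = ≤-trans (m≤m⊔n (length ν) (length ρ)) (m≤n⊔m (length κ ⊔ length μ) _)
  ρ≤n : length ρ ≤ n
  ρ≤n = ≤-trans (m≤n⊔m (length ν) (length ρ)) (m≤n⊔m (length κ ⊔ length μ) _)
  lower-extend : sumBelow lower n ≡ sumBelow lower (suc n)
  lower-extend = sym (trans (cong (sumBelow lower n +_)
    (cong₂ _⊓_ (!-beyond-length μ n μ≤n) (!-beyond-length ν n ν≤n))) (+-identityʳ _))
  regroup : ∀ m a b c → m + a + b + c ≡ m + (b + (a + c))
  regroup = solve-∀

rsk-transpose : ∀ {m κ μ ν ρ} → RSKRule m κ μ ν ρ → RSKRule m κ ν μ ρ
rsk-transpose {m} {κ} {μ} {ν} {ρ} (pκ , pμ , pν , pρ , κ≺μ , κ≺ν , μ≺ρ , ν≺ρ , first , rest) =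
  pκ , pν , pμ , pρ , κ≺ν , κ≺μ , ν≺ρ , μ≺ρ ,
  trans first (cong (m +_) (⊔-comm (μ ! 0) (ν ! 0))) ,
  λ k → trans (rest k) (cong₂ _+_ (⊓-comm (μ ! k) (ν ! k)) (⊔-comm (μ ! suc k) (ν ! suc k)))

rsk-backward-unique : ∀ {m m′ κ κ′ μ ν ρ} → RSKRule m κ μ ν ρ → RSKRule m′ κ′ μ ν ρ → m ≡ m′ × κ ≡ κ′
rsk-backward-unique {m} {m′} {κ} {κ′} {μ} {ν} {ρ}
  ((_ , κ⁺) , _ , _ , _ , _ , _ , _ , _ , first , rest) ((_ , κ′⁺) , _ , _ , _ , _ , _ , _ , _ , first′ , rest′) =
  +-cancelʳ-≡ (μ ! 0 ⊔ ν ! 0) m m′ (trans (sym first) first′) ,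
  !-extensionality κ κ′ κ⁺ κ′⁺ (λ k → +-cancelˡ-≡ (ρ ! suc k) (κ ! k) (κ′ ! k) (trans (rest k) (sym (rest′ k))))

rsk-wellBehaved : WellBehaved RSKRule
rsk-wellBehaved = record
  { size-identity   = rsk-size-identity
  ; transpose       = rsk-transpose
  ; backward-unique = rsk-backward-unique
  }

drsk-size-identity : ∀ d {m κ μ ν ρ} → dRSKRule (suc d) m κ μ ν ρ → size ρ + size κ ≡ m + size μ + size ν
drsk-size-identity d {m} {κ} {μ} {ν} {ρ} ((_ , κ≤) , (_ , μ≤) , (_ , ν≤) , (_ , ρ≤) , _ , _ , _ , _ , _ , first , rest) =
  begin
    size ρ + size κ
  ≡⟨ cong₂ _+_ (sum-sumBelow ρ (suc d) ρ≤) (sum-sumBelow κ (suc d) κ≤) ⟩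
    sumBelow (ρ !_) (suc d) + (sumBelow (κ !_) d + κ ! d)
  ≡⟨ sym (+-assoc (sumBelow (ρ !_) (suc d)) _ _) ⟩
    sumBelow (ρ !_) (suc d) + sumBelow (κ !_) d + κ ! d
  ≡⟨ cong (_+ κ ! d) (telescope d (λ k k<d → rest k (s≤s k<d))) ⟩
    ρ ! 0 + sumBelow lower d + sumBelow (upper ∘ suc) d + κ ! d
  ≡⟨ regroup (ρ ! 0) (sumBelow lower d) (sumBelow (upper ∘ suc) d) (κ ! d) ⟩
    (ρ ! 0 + κ ! d) + sumBelow lower d + sumBelow (upper ∘ suc) d
  ≡⟨ cong (λ r → r + sumBelow lower d + sumBelow (upper ∘ suc) d) first ⟩
    m + lower d + upper 0 + sumBelow lower d + sumBelow (upper ∘ suc) d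
  ≡⟨ regroup′ m (lower d) (upper 0) (sumBelow lower d) (sumBelow (upper ∘ suc) d) ⟩
    m + ((sumBelow lower d + lower d) + (upper 0 + sumBelow (upper ∘ suc) d))
  ≡⟨ cong (λ s → m + (sumBelow lower (suc d) + s)) (sym (sumBelow-front upper d)) ⟩
    m + (sumBelow lower (suc d) + sumBelow upper (suc d))
  ≡⟨ cong (m +_) (lower+upper (suc d) μ≤ ν≤) ⟩
    m + (size μ + size ν)
  ≡⟨ sym (+-assoc m _ _) ⟩
    m + size μ + size ν
  ∎
  where
  open ≡-Reasoning
  open LocalRuleSums κ μ ν ρ
  regroup : ∀ r a b k → r + a + b + k ≡ (r + k) + a + b
  regroup = solve-∀
  regroup′ : ∀ m a b c e → m + a + b + c + e ≡ m + ((c + a) + (b + e))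
  regroup′ = solve-∀

drsk-transpose : ∀ d {m κ μ ν ρ} → dRSKRule d m κ μ ν ρ → dRSKRule d m κ ν μ ρ
drsk-transpose d {m} {κ} {μ} {ν} {ρ} (pκ , pμ , pν , pρ , κ≺μ , κ≺ν , μ≺ρ , ν≺ρ , m⊎κ , first , rest) =
  pκ , pν , pμ , pρ , κ≺ν , κ≺μ , ν≺ρ , μ≺ρ , m⊎κ ,
  trans first (cong₂ (λ a b → m + a + b) (⊓-comm (μ ! (d ∸ 1)) (ν ! (d ∸ 1))) (⊔-comm (μ ! 0) (ν ! 0))) ,
  λ k k<d → trans (rest k k<d) (cong₂ _+_ (⊓-comm (μ ! k) (ν ! k)) (⊔-comm (μ ! suc k) (ν ! suc k)))

excess-vanishes : ∀ {r a z m′} → r + a ≡ z → r ≡ m′ + z → m′ ≡ 0 × a ≡ 0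
excess-vanishes {r} {a} {z} {m′} eq eq′ = m+n≡0⇒m≡0 m′ m′+a≡0 , m+n≡0⇒n≡0 m′ m′+a≡0
  where
  open ≡-Reasoning
  rearrange : ∀ z m a → z + (m + a) ≡ m + z + a
  rearrange = solve-∀
  m′+a≡0 : m′ + a ≡ 0
  m′+a≡0 = +-cancelˡ-≡ z (m′ + a) 0 (begin
    z + (m′ + a) ≡⟨ rearrange z m′ a ⟩
    m′ + z + a   ≡⟨ cong (_+ a) (sym eq′) ⟩
    r + a        ≡⟨ eq ⟩
    z            ≡⟨ sym (+-identityʳ z) ⟩
    z + 0        ∎)

-- In  r + a = m + z  at most one of m and a is nonzero, so the split is forced.
split-unique : ∀ {r a a′ m m′ z} → r + a ≡ m + z → r + a′ ≡ m′ + z →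
  m ≡ 0 ⊎ a ≡ 0 → m′ ≡ 0 ⊎ a′ ≡ 0 → m ≡ m′ × a ≡ a′
split-unique {r} eq eq′ (inj₁ refl) (inj₁ refl) = refl , +-cancelˡ-≡ r _ _ (trans eq (sym eq′))
split-unique {z = z} eq eq′ (inj₂ refl) (inj₂ refl) = +-cancelʳ-≡ z _ _ (trans (sym eq) eq′) , refl
split-unique {r} eq eq′ (inj₁ refl) (inj₂ refl) =
  let m′≡0 , a≡0 = excess-vanishes eq (trans (sym (+-identityʳ r)) eq′) in sym m′≡0 , a≡0
split-unique {r} eq eq′ (inj₂ refl) (inj₁ refl) =
  let m≡0 , a′≡0 = excess-vanishes eq′ (trans (sym (+-identityʳ r)) eq) in m≡0 , sym a′≡0

drsk-backward-unique : ∀ d {m m′ κ κ′ μ ν ρ} →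
  dRSKRule (suc d) m κ μ ν ρ → dRSKRule (suc d) m′ κ′ μ ν ρ → m ≡ m′ × κ ≡ κ′
drsk-backward-unique d {m} {m′} {κ} {κ′} {μ} {ν} {ρ}
  (((_ , κ⁺) , κ≤) , _ , _ , _ , _ , _ , _ , _ , m⊎κ , first , rest)
  (((_ , κ′⁺) , κ′≤) , _ , _ , _ , _ , _ , _ , _ , m′⊎κ′ , first′ , rest′) =
  proj₁ last-entry , !-extensionality κ κ′ κ⁺ κ′⁺ entrywise
  where
  last-entry : m ≡ m′ × κ ! d ≡ κ′ ! d
  last-entry = split-unique (trans first (+-assoc m _ _)) (trans first′ (+-assoc m′ _ _)) m⊎κ m′⊎κ′
  entrywise : ∀ k → κ ! k ≡ κ′ ! k
  entrywise k with <-cmp k d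
  ... | tri< k<d _ _  = +-cancelˡ-≡ (ρ ! suc k) _ _ (trans (rest k (s≤s k<d)) (sym (rest′ k (s≤s k<d))))
  ... | tri≈ _ refl _ = proj₂ last-entry
  ... | tri> _ _ d<k  =
    trans (!-beyond-length κ k (≤-trans κ≤ d<k)) (sym (!-beyond-length κ′ k (≤-trans κ′≤ d<k)))

drsk-wellBehaved : ∀ d → WellBehaved (dRSKRule (suc d))
drsk-wellBehaved d = record
  { size-identity   = drsk-size-identity d
  ; transpose       = drsk-transpose (suc d)
  ; backward-unique = drsk-backward-unique d
  }

-- Conjugate partitions

Descending : List ℕ → Set
Descending []         = ⊤
Descending (a ∷ rest) = head0 rest ≤ a × Descending rest

linked⇒descending : ∀ l → Linked (λ a b → b ≤ a) l → Descending l
linked⇒descending []          _         = tt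
linked⇒descending (_ ∷ [])    _         = z≤n , tt
linked⇒descending (_ ∷ b ∷ l) (b≤a ∷ r) = b≤a , linked⇒descending (b ∷ l) r

!-≤-head : ∀ l → Descending l → ∀ k → l ! k ≤ head0 l
!-≤-head []         _         k       = z≤n
!-≤-head (_ ∷ _)    _         zero    = ≤-refl
!-≤-head (_ ∷ rest) (h≤a , d) (suc k) = ≤-trans (!-≤-head rest d k) h≤a

!-suc-≤ : ∀ l → Descending l → ∀ k → l ! suc k ≤ l ! k
!-suc-≤ []         _         k       = z≤n
!-suc-≤ (_ ∷ rest) (h≤a , _) zero    = ≤-trans (≤-reflexive (!-0 rest)) h≤a
!-suc-≤ (_ ∷ rest) (_ , d)   (suc k) = !-suc-≤ rest d k

!-suc-≤⇒descending : ∀ l → (∀ k → l ! suc k ≤ l ! k) → Descending l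
!-suc-≤⇒descending []         _    = tt
!-suc-≤⇒descending (_ ∷ rest) mono =
  ≤-trans (≤-reflexive (sym (!-0 rest))) (mono 0) , !-suc-≤⇒descending rest (mono ∘ suc)

countAtLeast : ℕ → List ℕ → ℕ
countAtLeast j l = length (filter (j ≤?_) l)

countAtLeast-accept : ∀ {j a} l → j ≤ a → countAtLeast j (a ∷ l) ≡ suc (countAtLeast j l)
countAtLeast-accept {j} l j≤a = cong length (filter-accept (j ≤?_) j≤a)

countAtLeast-reject : ∀ {j a} l → ¬ j ≤ a → countAtLeast j (a ∷ l) ≡ countAtLeast j l
countAtLeast-reject {j} l j≰a = cong length (filter-reject (j ≤?_) j≰a)

countAtLeast-1 : ∀ l → All (1 ≤_) l → countAtLeast 1 l ≡ length l
countAtLeast-1 l l⁺ = cong length (filter-all (1 ≤?_) l⁺)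

countAtLeast-beyond-head : ∀ j l → Descending l → head0 l < j → countAtLeast j l ≡ 0
countAtLeast-beyond-head j []         _         _   = refl
countAtLeast-beyond-head j (a ∷ rest) (h≤a , d) a<j =
  trans (countAtLeast-reject rest (<⇒≱ a<j)) (countAtLeast-beyond-head j rest d (≤-<-trans h≤a a<j))

countAtLeast-suc-≤ : ∀ j l → countAtLeast (suc j) l ≤ countAtLeast j l
countAtLeast-suc-≤ j []      = z≤n
countAtLeast-suc-≤ j (a ∷ l) with suc j ≤? a | j ≤? a
... | yes p | yes q rewrite countAtLeast-accept l p | countAtLeast-accept l q = s≤s (countAtLeast-suc-≤ j l)
... | yes p | no ¬q = contradiction (≤-trans (n≤1+n j) p) ¬q
... | no ¬p | yes q rewrite countAtLeast-reject l ¬p | countAtLeast-accept l q =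
  m≤n⇒m≤1+n (countAtLeast-suc-≤ j l)
... | no ¬p | no ¬q rewrite countAtLeast-reject l ¬p | countAtLeast-reject l ¬q = countAtLeast-suc-≤ j l

<countAtLeast⇒≤! : ∀ j l → Descending l → 1 ≤ j → ∀ i → i < countAtLeast j l → j ≤ l ! i
<countAtLeast⇒≤! j []         _         _   i i<c = contradiction i<c λ ()
<countAtLeast⇒≤! j (a ∷ rest) (h≤a , d) 1≤j i i<c with j ≤? a
... | yes j≤a = accepted i (subst (i <_) (countAtLeast-accept rest j≤a) i<c)
  where
  accepted : ∀ i → i < suc (countAtLeast j rest) → j ≤ (a ∷ rest) ! i
  accepted zero    _         = j≤a
  accepted (suc i) (s<s i<c) = <countAtLeast⇒≤! j rest d 1≤j i i<c
... | no j≰a = contradiction (subst (i <_) rest-empty i<c) λ ()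
  where
  rest-empty : countAtLeast j (a ∷ rest) ≡ 0
  rest-empty = countAtLeast-beyond-head j (a ∷ rest) (h≤a , d) (≰⇒> j≰a)

≤!⇒<countAtLeast : ∀ j l → Descending l → 1 ≤ j → ∀ i → j ≤ l ! i → i < countAtLeast j l
≤!⇒<countAtLeast (suc j) []         _         _   i       ()
≤!⇒<countAtLeast j       (a ∷ rest) (h≤a , d) 1≤j i       j≤l!i with j ≤? a
... | no j≰a = contradiction (≤-trans j≤l!i (!-≤-head (a ∷ rest) (h≤a , d) i)) j≰a
... | yes j≤a = subst (i <_) (sym (countAtLeast-accept rest j≤a)) (accepted i j≤l!i)
  where
  accepted : ∀ i → j ≤ (a ∷ rest) ! i → i < suc (countAtLeast j rest)
  accepted zero    _     = z<s
  accepted (suc i) j≤l!i = s<s (≤!⇒<countAtLeast j rest d 1≤j i j≤l!i)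

conj-applyUpTo : ∀ F → conj F ≡ applyUpTo (λ k → countAtLeast (suc k) F) (F ! 0)
conj-applyUpTo F = trans (cong (map (λ j → countAtLeast j F)) (oneTo-applyUpTo (F ! 0)))
                         (map-applyUpTo suc (λ j → countAtLeast j F) (F ! 0))

length-conj : ∀ F → length (conj F) ≡ F ! 0
length-conj F = trans (length-map _ (oneTo (F ! 0))) (length-oneTo (F ! 0))

conj-! : ∀ F → Descending F → ∀ k → conj F ! k ≡ countAtLeast (suc k) F
conj-! F d k with k <? F ! 0
... | yes k<F₁ = trans (cong (_! k) (conj-applyUpTo F)) (applyUpTo-! _ (F ! 0) k k<F₁)
... | no k≮F₁  = trans (!-beyond-length (conj F) k (subst (_≤ k) (sym (length-conj F)) F₁≤k))
                       (sym (countAtLeast-beyond-head (suc k) F d (s≤s (subst (_≤ k) (!-0 F) F₁≤k))))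
  where
  F₁≤k : F ! 0 ≤ k
  F₁≤k = ≮⇒≥ k≮F₁

conj-descending : ∀ F → Descending F → Descending (conj F)
conj-descending F d = !-suc-≤⇒descending (conj F) λ k →
  subst₂ _≤_ (sym (conj-! F d (suc k))) (sym (conj-! F d k)) (countAtLeast-suc-≤ (suc k) F)

conj-!-0 : ∀ F → Descending F → All (1 ≤_) F → conj F ! 0 ≡ length F
conj-!-0 F d F⁺ = trans (conj-! F d 0) (countAtLeast-1 F F⁺)

latticePt-conj : ∀ F → Descending F → ∀ x y → LatticePt (conj F) x y → LatticePt F y x
latticePt-conj F d x y (y≤ , x≤) =
  ≤-trans x≤ (≤-trans (≤-reflexive (conj-! F d (pred y))) (length-filter (suc (pred y) ≤?_) F)) , column x y y≤ x≤
  where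
  column : ∀ x y → y ≤ length (conj F) → x ≤ conj F ! pred y → y ≤ F ! pred x
  column zero    y       y≤ _  = subst (y ≤_) (length-conj F) y≤
  column (suc x) zero    _  _  = z≤n
  column (suc x) (suc y) _  x< = <countAtLeast⇒≤! (suc y) F d (s≤s z≤n) x (subst (x <_) (conj-! F d y) x<)

cell-conj : ∀ F → Descending F → ∀ i j → Cell (conj F) i j → Cell F j i
cell-conj F d (suc i) (suc j) (_ , _ , j<) =
  s≤s z≤n , s≤s z≤n , <countAtLeast⇒≤! (suc i) F d (s≤s z≤n) j (subst (j <_) (conj-! F d i) j<)

conj-∷ : ∀ a rest → Descending (a ∷ rest) → conj (a ∷ rest) ≡ map suc (conj rest) ++ replicate (a ∸ head0 rest) 1
conj-∷ a rest (h≤a , d) = begin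
    conj (a ∷ rest)
  ≡⟨ conj-applyUpTo (a ∷ rest) ⟩
    applyUpTo f a
  ≡⟨ cong (applyUpTo f) (sym (m+[n∸m]≡n h≤a)) ⟩
    applyUpTo f (h + n)
  ≡⟨ applyUpTo-++ f h n ⟩
    applyUpTo f h ++ applyUpTo (f ∘ (h +_)) n
  ≡⟨ cong₂ _++_ (applyUpTo-cong h (λ k k<h → countAtLeast-accept rest (≤-trans k<h h≤a)))
                (applyUpTo-cong n (λ i i<n → trans (countAtLeast-accept rest (h+i<a i<n)) (cong suc (beyond i)))) ⟩
    applyUpTo (suc ∘ g) h ++ applyUpTo (λ _ → 1) n
  ≡⟨ cong₂ _++_ (sym (map-applyUpTo g suc h)) (applyUpTo-const 1 n) ⟩
    map suc (applyUpTo g h) ++ replicate n 1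
  ≡⟨ cong (λ c → map suc c ++ replicate n 1) (sym (trans (conj-applyUpTo rest) (cong (applyUpTo g) (!-0 rest)))) ⟩
    map suc (conj rest) ++ replicate n 1
  ∎
  where
  open ≡-Reasoning
  h n : ℕ
  h = head0 rest
  n = a ∸ h
  f g : ℕ → ℕ
  f k = countAtLeast (suc k) (a ∷ rest)
  g k = countAtLeast (suc k) rest
  h+i<a : ∀ {i} → i < n → suc (h + i) ≤ a
  h+i<a {i} i<n = subst (suc (h + i) ≤_) (m+[n∸m]≡n h≤a) (subst (_≤ h + n) (+-suc h i) (+-monoʳ-≤ h i<n))
  beyond : ∀ i → g (h + i) ≡ 0
  beyond i = countAtLeast-beyond-head (suc (h + i)) rest d (s≤s (m≤m+n h i))

dualWord-∷ : ∀ s w → dualWord (s ∷ w) ≡ dualWord w ∷ʳ swap s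
dualWord-∷ s w = unfold-reverse (swap s) (map swap w)

dualWord-++ : ∀ u v → dualWord (u ++ v) ≡ dualWord v ++ dualWord u
dualWord-++ u v = trans (cong reverse (map-++ swap u v)) (reverse-++ (map swap u) (map swap v))

dualWord-minuses : ∀ n → dualWord (replicate n minus) ≡ replicate n plus
dualWord-minuses zero    = refl
dualWord-minuses (suc n) = trans (dualWord-∷ minus (replicate n minus))
  (trans (cong (_∷ʳ plus) (dualWord-minuses n)) (sym (replicate-∷ʳ n plus)))

word-ones : ∀ n → word (replicate (suc n) 1) ≡ replicate (suc n) plus ∷ʳ minus
word-ones zero    = refl
word-ones (suc n) = cong (plus ∷_) (word-ones n)

-- Adding a column of height n at the left of the diagram G.
word-extend : ∀ G n → 1 ≤ length G + n → word (map suc G ++ replicate n 1) ≡ word G ++ (replicate n plus ∷ʳ minus)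
word-extend []           (suc n) _ = word-ones n
word-extend (g ∷ [])     zero    _ = cong (plus ∷_) (trans (++-identityʳ (replicate (suc g) minus))
  (trans (replicate-∷ʳ g minus) (cong (_∷ʳ minus) (sym (++-identityʳ (replicate g minus))))))
word-extend (g ∷ [])     (suc n) _ = cong (plus ∷_) (trans (cong (replicate g minus ++_) (word-ones n))
  (cong (_++ (replicate (suc n) plus ∷ʳ minus)) (sym (++-identityʳ (replicate g minus)))))
word-extend (g ∷ g′ ∷ G) n       _ = cong (plus ∷_) (trans (cong (replicate (g ∸ g′) minus ++_) (word-extend (g′ ∷ G) n (s≤s z≤n)))
  (sym (++-assoc (replicate (g ∸ g′) minus) (word (g′ ∷ G)) _)))

word-conj : ∀ F → Descending F → All (1 ≤_) F → word (conj F) ≡ dualWord (word F)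
word-conj []         _         _        = refl
word-conj (a ∷ rest) (h≤a , d) (1≤a ∷ rest⁺) = begin
    word (conj (a ∷ rest))
  ≡⟨ cong word (conj-∷ a rest (h≤a , d)) ⟩
    word (map suc (conj rest) ++ replicate n 1)
  ≡⟨ word-extend (conj rest) n nonempty ⟩
    word (conj rest) ++ (replicate n plus ∷ʳ minus)
  ≡⟨ cong (_++ (replicate n plus ∷ʳ minus)) (word-conj rest d rest⁺) ⟩
    dualWord (word rest) ++ (replicate n plus ∷ʳ minus)
  ≡⟨ sym (++-assoc (dualWord (word rest)) _ _) ⟩
    (dualWord (word rest) ++ replicate n plus) ∷ʳ minus
  ≡⟨ cong (λ u → (dualWord (word rest) ++ u) ∷ʳ minus) (sym (dualWord-minuses n)) ⟩
    (dualWord (word rest) ++ dualWord (replicate n minus)) ∷ʳ minus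
  ≡⟨ cong (_∷ʳ minus) (sym (dualWord-++ (replicate n minus) (word rest))) ⟩
    dualWord (replicate n minus ++ word rest) ∷ʳ minus
  ≡⟨ sym (dualWord-∷ plus (replicate n minus ++ word rest)) ⟩
    dualWord (word (a ∷ rest))
  ∎
  where
  open ≡-Reasoning
  n : ℕ
  n = a ∸ head0 rest
  nonempty : 1 ≤ length (conj rest) + n
  nonempty = subst (1 ≤_) (sym (trans (cong (_+ n) (trans (length-conj rest) (!-0 rest))) (m+[n∸m]≡n h≤a))) 1≤a

-- The outer boundary as a lattice path

Point : Set
Point = ℕ × ℕ

move : Sign → Point → Point
move plus  (x , y) = x , suc y
move minus (x , y) = pred x , y

trail : Point → List Sign → List Point
trail p []      = []
trail p (s ∷ w) = move s p ∷ trail (move s p) w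

path : Point → List Sign → List Point
path p w = p ∷ trail p w

endpoint : Point → List Sign → Point
endpoint p []      = p
endpoint p (s ∷ w) = endpoint (move s p) w

transposePt : Point → Point
transposePt (x , y) = y , x

-- move minus truncates at x = 0; reversing a path needs it never to do so.
Admissible : Point → List Sign → Set
Admissible p           []          = ⊤
Admissible p           (plus ∷ w)  = Admissible (move plus p) w
Admissible p@(x , _)   (minus ∷ w) = 1 ≤ x × Admissible (move minus p) w

pred-∸ : ∀ x t → pred x ∸ t ≡ x ∸ suc t
pred-∸ zero    t = 0∸n≡0 t
pred-∸ (suc x) t = refl

trail-minuses : ∀ n x y w →
  trail (x , y) (replicate n minus ++ w) ≡ applyUpTo (λ t → x ∸ suc t , y) n ++ trail (x ∸ n , y) w
trail-minuses zero    x y w = refl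
trail-minuses (suc n) x y w = cong ((pred x , y) ∷_) (trans (trail-minuses n (pred x) y w)
  (cong₂ _++_ (applyUpTo-cong n (λ t _ → cong (_, y) (pred-∸ x (suc t))))
              (cong (λ z → trail (z , y) w) (pred-∸ x n))))

endpoint-minuses : ∀ n x y w → endpoint (x , y) (replicate n minus ++ w) ≡ endpoint (x ∸ n , y) w
endpoint-minuses zero    x y w = refl
endpoint-minuses (suc n) x y w = trans (endpoint-minuses n (pred x) y w) (cong (λ z → endpoint (z , y) w) (pred-∸ x n))

admissible-minuses : ∀ n x y w → n ≤ x → Admissible (x ∸ n , y) w → Admissible (x , y) (replicate n minus ++ w)
admissible-minuses zero    x       y w _         adm = adm
admissible-minuses (suc n) (suc x) y w (s≤s n≤x) adm = s≤s z≤n , admissible-minuses n x y w n≤x adm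

trail-word : ∀ G y → Descending G → trail (head0 G , y) (word G) ≡ boundaryFrom (suc y) G
trail-word []         y _         = refl
trail-word (a ∷ rest) y (h≤a , d) = cong ((a , suc y) ∷_) (begin
    trail (a , suc y) (replicate n minus ++ word rest)
  ≡⟨ trail-minuses n a (suc y) (word rest) ⟩
    applyUpTo (λ t → a ∸ suc t , suc y) n ++ trail (a ∸ n , suc y) (word rest)
  ≡⟨ cong₂ _++_ (sym (map-upTo _ n)) (cong (λ x → trail (x , suc y) (word rest)) (m∸[m∸n]≡n h≤a)) ⟩
    map (λ t → a ∸ suc t , suc y) (upTo n) ++ trail (head0 rest , suc y) (word rest)
  ≡⟨ cong (map (λ t → a ∸ suc t , suc y) (upTo n) ++_) (trail-word rest (suc y) d) ⟩
    map (λ t → a ∸ suc t , suc y) (upTo n) ++ boundaryFrom (suc (suc y)) rest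
  ∎)
  where
  open ≡-Reasoning
  n : ℕ
  n = a ∸ head0 rest

boundaryPoints-path : ∀ G → Descending G → boundaryPoints G ≡ path (head0 G , 0) (word G)
boundaryPoints-path G d = cong₂ _∷_ (cong (_, 0) (!-0 G)) (sym (trail-word G 0 d))

admissible-word : ∀ G y → Descending G → Admissible (head0 G , y) (word G)
admissible-word []         y _         = tt
admissible-word (a ∷ rest) y (h≤a , d) =
  admissible-minuses (a ∸ head0 rest) a (suc y) (word rest) (m∸n≤m a (head0 rest))
    (subst (λ x → Admissible (x , suc y) (word rest)) (sym (m∸[m∸n]≡n h≤a)) (admissible-word rest (suc y) d))

endpoint-word : ∀ G y → Descending G → endpoint (head0 G , y) (word G) ≡ (0 , y + length G)
endpoint-word []         y _         = cong (0 ,_) (sym (+-identityʳ y))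
endpoint-word (a ∷ rest) y (h≤a , d) =
  trans (endpoint-minuses (a ∸ head0 rest) a (suc y) (word rest))
    (trans (cong (λ x → endpoint (x , suc y) (word rest)) (m∸[m∸n]≡n h≤a))
      (trans (endpoint-word rest (suc y) d) (cong (0 ,_) (sym (+-suc y (length rest))))))

path-∷ʳ : ∀ p u s → path p (u ∷ʳ s) ≡ path p u ∷ʳ move s (endpoint p u)
path-∷ʳ p []      s = refl
path-∷ʳ p (t ∷ u) s = cong (p ∷_) (path-∷ʳ (move t p) u s)

endpoint-∷ʳ : ∀ p u s → endpoint p (u ∷ʳ s) ≡ move s (endpoint p u)
endpoint-∷ʳ p []      s = refl
endpoint-∷ʳ p (t ∷ u) s = endpoint-∷ʳ (move t p) u s

move-swap-transpose : ∀ s p w → Admissible p (s ∷ w) → move (swap s) (transposePt (move s p)) ≡ transposePt p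
move-swap-transpose plus  (x , y)     w _ = refl
move-swap-transpose minus (suc x , y) w _ = refl

admissible-tail : ∀ s p w → Admissible p (s ∷ w) → Admissible (move s p) w
admissible-tail plus  p w adm       = adm
admissible-tail minus p w (_ , adm) = adm

path-reverse : ∀ p w → Admissible p w →
  map transposePt (reverse (path p w)) ≡ path (transposePt (endpoint p w)) (dualWord w) ×
  endpoint (transposePt (endpoint p w)) (dualWord w) ≡ transposePt p
path-reverse p []      _   = refl , refl
path-reverse p (s ∷ w) adm = reversed , ends
  where
  p′ e : Point
  p′ = move s p
  e  = transposePt (endpoint p′ w)
  ih = path-reverse p′ w (admissible-tail s p w adm)
  last-step : move (swap s) (endpoint e (dualWord w)) ≡ transposePt p
  last-step = trans (cong (move (swap s)) (proj₂ ih)) (move-swap-transpose s p w adm)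
  reversed : map transposePt (reverse (p ∷ path p′ w)) ≡ path e (dualWord (s ∷ w))
  reversed = begin
      map transposePt (reverse (p ∷ path p′ w))
    ≡⟨ cong (map transposePt) (unfold-reverse p (path p′ w)) ⟩
      map transposePt (reverse (path p′ w) ∷ʳ p)
    ≡⟨ map-++ transposePt (reverse (path p′ w)) (p ∷ []) ⟩
      map transposePt (reverse (path p′ w)) ∷ʳ transposePt p
    ≡⟨ cong₂ _∷ʳ_ (proj₁ ih) (sym last-step) ⟩
      path e (dualWord w) ∷ʳ move (swap s) (endpoint e (dualWord w))
    ≡⟨ sym (path-∷ʳ e (dualWord w) (swap s)) ⟩
      path e (dualWord w ∷ʳ swap s)
    ≡⟨ cong (path e) (sym (dualWord-∷ s w)) ⟩
      path e (dualWord (s ∷ w))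
    ∎
    where open ≡-Reasoning
  ends : endpoint e (dualWord (s ∷ w)) ≡ transposePt p
  ends = trans (cong (endpoint e) (dualWord-∷ s w)) (trans (endpoint-∷ʳ e (dualWord w) (swap s)) last-step)

at : (ℕ → ℕ → List ℕ) → Point → List ℕ
at P p = P (proj₁ p) (proj₂ p)

carries-path : ∀ G → Descending G → ∀ P T → Carries G P T → map (at P) (path (head0 G , 0) (word G)) ≡ T
carries-path G d P T carries = trans (cong (map (at P)) (sym (boundaryPoints-path G d))) carries

carries-conj : ∀ F → Descending F → All (1 ≤_) F → ∀ P T → Carries F P T → Carries (conj F) (reflectPts P) (reverse T)
carries-conj F d F⁺ P T carries = begin
    map (at P′) (boundaryPoints (conj F))
  ≡⟨ cong (map (at P′)) (boundaryPoints-path (conj F) (conj-descending F d)) ⟩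
    map (at P′) (path (head0 (conj F) , 0) (word (conj F)))
  ≡⟨ cong₂ (λ x w → map (at P′) (path (x , 0) w)) (trans (sym (!-0 (conj F))) (conj-!-0 F d F⁺)) (word-conj F d F⁺) ⟩
    map (at P′) (path (length F , 0) (dualWord (word F)))
  ≡⟨ cong (λ e → map (at P′) (path (transposePt e) (dualWord (word F)))) (sym (endpoint-word F 0 d)) ⟩
    map (at P′) (path (transposePt (endpoint p₀ (word F))) (dualWord (word F)))
  ≡⟨ cong (map (at P′)) (sym (proj₁ (path-reverse p₀ (word F) (admissible-word F 0 d)))) ⟩
    map (at P′) (map transposePt (reverse (path p₀ (word F))))
  ≡⟨ sym (map-∘ (reverse (path p₀ (word F)))) ⟩
    map (at P) (reverse (path p₀ (word F)))
  ≡⟨ reverse-map (at P) (path p₀ (word F)) ⟩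
    reverse (map (at P) (path p₀ (word F)))
  ≡⟨ cong reverse (carries-path F d P T carries) ⟩
    reverse T
  ∎
  where
  open ≡-Reasoning
  P′ : ℕ → ℕ → List ℕ
  P′ = reflectPts P
  p₀ : Point
  p₀ = head0 F , 0

reflect-growth : ∀ {R} → WellBehaved R → ∀ F → Descending F → ∀ A P → IsGrowth R F A P →
  IsGrowth R (conj F) (reflectFilling A) (reflectPts P)
reflect-growth wb F d A P growth = record
  { partitionAt = λ x y pt → partitionAt y x (latticePt-conj F d x y pt)
  ; emptyOnAxes = λ x y pt onAxis → emptyOnAxes y x (latticePt-conj F d x y pt) (Data.Sum.swap onAxis)
  ; local       = λ i j cell → WellBehaved.transpose wb (local j i (cell-conj F d i j cell))
  }
  where open IsGrowth growth

-- Row sums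

wtPlus-minuses : ∀ Q n x y w →
  wtPlus (replicate n minus ++ w) (map Q (path (x , y) (replicate n minus ++ w))) ≡ wtPlus w (map Q (path (x ∸ n , y) w))
wtPlus-minuses Q zero    x y w = refl
wtPlus-minuses Q (suc n) x y w =
  trans (wtPlus-minuses Q n (pred x) y w) (cong (λ z → wtPlus w (map Q (path (z , y) w))) (pred-∸ x n))

wtPlus-word : ∀ Q G y → Descending G →
  wtPlus (word G) (map Q (path (head0 G , y) (word G))) ≡
  applyUpTo (λ k → size (Q (G ! k , suc (y + k))) ∸ size (Q (G ! k , y + k))) (length G)
wtPlus-word Q []         y _         = refl
wtPlus-word Q (a ∷ rest) y (h≤a , d) = cong₂ _∷_
  (cong (λ z → size (Q (a , suc z)) ∸ size (Q (a , z))) (sym (+-identityʳ y)))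
  (begin
    wtPlus (replicate n minus ++ word rest) (map Q (path (a , suc y) (replicate n minus ++ word rest)))
  ≡⟨ wtPlus-minuses Q n a (suc y) (word rest) ⟩
    wtPlus (word rest) (map Q (path (a ∸ n , suc y) (word rest)))
  ≡⟨ cong (λ x → wtPlus (word rest) (map Q (path (x , suc y) (word rest)))) (m∸[m∸n]≡n h≤a) ⟩
    wtPlus (word rest) (map Q (path (head0 rest , suc y) (word rest)))
  ≡⟨ wtPlus-word Q rest (suc y) d ⟩
    applyUpTo (λ k → size (Q (rest ! k , suc (suc y + k))) ∸ size (Q (rest ! k , suc y + k))) (length rest)
  ≡⟨ applyUpTo-cong (length rest) (λ k _ →
       cong (λ z → size (Q (rest ! k , suc z)) ∸ size (Q (rest ! k , z))) (sym (+-suc y k))) ⟩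
    applyUpTo (λ k → size (Q (rest ! k , suc (y + suc k))) ∸ size (Q (rest ! k , y + suc k))) (length rest)
  ∎)
  where
  open ≡-Reasoning
  n : ℕ
  n = a ∸ head0 rest

module Rows {R : LocalRule} (wb : WellBehaved R) {G A P} (growth : IsGrowth R G A P) where
  open IsGrowth growth

  row-telescope : ∀ k → k < length G → ∀ x → x ≤ G ! k →
    sum (applyUpTo (λ j → A (suc k) (suc j)) x) + size (P x k) ≡ size (P x (suc k))
  row-telescope k k<ℓ zero _
    rewrite emptyOnAxes 0 k (≤-trans (n≤1+n k) k<ℓ , z≤n) (inj₁ refl)
          | emptyOnAxes 0 (suc k) (k<ℓ , z≤n) (inj₁ refl) = refl
  row-telescope k k<ℓ (suc x) x<G!k = +-cancelʳ-≡ (size κ) _ _ (begin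
      sum (applyUpTo f (suc x)) + size ν + size κ
    ≡⟨ cong (λ l → sum l + size ν + size κ) (sym (applyUpTo-∷ʳ f x)) ⟩
      sum (applyUpTo f x ∷ʳ m) + size ν + size κ
    ≡⟨ cong (λ s → s + size ν + size κ) (sum-++ (applyUpTo f x) (m ∷ [])) ⟩
      sum (applyUpTo f x) + (m + 0) + size ν + size κ
    ≡⟨ regroup (sum (applyUpTo f x)) m (size ν) (size κ) ⟩
      m + (sum (applyUpTo f x) + size κ) + size ν
    ≡⟨ cong (λ s → m + s + size ν) (row-telescope k k<ℓ x (≤-trans (n≤1+n x) x<G!k)) ⟩
      m + size μ + size ν
    ≡⟨ sym (WellBehaved.size-identity wb (local (suc k) (suc x) (s≤s z≤n , s≤s z≤n , x<G!k))) ⟩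
      size ρ + size κ
    ∎)
    where
    open ≡-Reasoning
    f : ℕ → ℕ
    f j = A (suc k) (suc j)
    m : ℕ
    m = A (suc k) (suc x)
    κ μ ν ρ : List ℕ
    κ = P x k
    μ = P x (suc k)
    ν = P (suc x) k
    ρ = P (suc x) (suc k)
    regroup : ∀ s m n k → s + (m + 0) + n + k ≡ m + (s + k) + n
    regroup = solve-∀

  rowSum-increment : ∀ k → k < length G → rowSum G A (suc k) ≡ size (P (G ! k) (suc k)) ∸ size (P (G ! k) k)
  rowSum-increment k k<ℓ = begin
      sum (map (A (suc k)) (oneTo (G ! k)))
    ≡⟨ cong sum (map-oneTo (A (suc k)) (G ! k)) ⟩
      sum (applyUpTo (λ j → A (suc k) (suc j)) (G ! k))
    ≡⟨ sym (m+n∸n≡m _ (size (P (G ! k) k))) ⟩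
      sum (applyUpTo (λ j → A (suc k) (suc j)) (G ! k)) + size (P (G ! k) k) ∸ size (P (G ! k) k)
    ≡⟨ cong (_∸ size (P (G ! k) k)) (row-telescope k k<ℓ (G ! k) ≤-refl) ⟩
      size (P (G ! k) (suc k)) ∸ size (P (G ! k) k)
    ∎
    where open ≡-Reasoning

  rowSums-wtPlus : Descending G → ∀ T → Carries G P T → rowSums G A ≡ wtPlus (word G) T
  rowSums-wtPlus d T carries = begin
      map (rowSum G A) (oneTo (length G))
    ≡⟨ map-oneTo (rowSum G A) (length G) ⟩
      applyUpTo (rowSum G A ∘ suc) (length G)
    ≡⟨ applyUpTo-cong (length G) rowSum-increment ⟩
      applyUpTo (λ k → size (P (G ! k) (suc k)) ∸ size (P (G ! k) k)) (length G)
    ≡⟨ sym (wtPlus-word (at P) G 0 d) ⟩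
      wtPlus (word G) (map (at P) (path (head0 G , 0) (word G)))
    ≡⟨ cong (wtPlus (word G)) (carries-path G d P T carries) ⟩
      wtPlus (word G) T
    ∎
    where open ≡-Reasoning

-- Column sums

filter-applyUpTo-prefix : ∀ {A : Set} {p} {P : Pred A p} (P? : Decidable P) (f : ℕ → A) {n m} → m ≤ n →
  (∀ i → i < n → P (f i) → i < m) → (∀ i → i < m → P (f i)) → filter P? (applyUpTo f n) ≡ applyUpTo f m
filter-applyUpTo-prefix P? f {zero}  z≤n       _    _    = refl
filter-applyUpTo-prefix P? f {suc n} {zero} z≤n only _ =
  trans (filter-reject P? (λ P[f0] → contradiction (only 0 z<s P[f0]) λ ()))
        (filter-applyUpTo-prefix P? (f ∘ suc) z≤n (λ i i<n P[fi] → contradiction (only (suc i) (s<s i<n) P[fi]) λ ()) λ _ ())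
filter-applyUpTo-prefix P? f {suc n} {suc m} (s≤s m≤n) only all =
  trans (filter-accept P? (all 0 z<s))
        (cong (f 0 ∷_) (filter-applyUpTo-prefix P? (f ∘ suc) m≤n
          (λ i i<n P[fi] → s<s⁻¹ (only (suc i) (s<s i<n) P[fi])) (λ i i<m → all (suc i) (s<s i<m))))

rowsOfColumn : ∀ F → Descending F → ∀ k →
  filter (λ i → suc k ≤? F ! (i ∸ 1)) (oneTo (length F)) ≡ oneTo (conj F ! k)
rowsOfColumn F d k = begin
    filter (λ i → suc k ≤? F ! (i ∸ 1)) (oneTo (length F))
  ≡⟨ cong (filter (λ i → suc k ≤? F ! (i ∸ 1))) (oneTo-applyUpTo (length F)) ⟩
    filter (λ i → suc k ≤? F ! (i ∸ 1)) (applyUpTo suc (length F))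
  ≡⟨ filter-applyUpTo-prefix (λ i → suc k ≤? F ! (i ∸ 1)) suc (length-filter (suc k ≤?_) F)
       (λ i _ → ≤!⇒<countAtLeast (suc k) F d (s≤s z≤n) i) (<countAtLeast⇒≤! (suc k) F d (s≤s z≤n)) ⟩
    applyUpTo suc (countAtLeast (suc k) F)
  ≡⟨ sym (trans (cong oneTo (conj-! F d k)) (oneTo-applyUpTo _)) ⟩
    oneTo (conj F ! k)
  ∎
  where open ≡-Reasoning

colSums-conj : ∀ F → Descending F → ∀ A → colSums F A ≡ rowSums (conj F) (reflectFilling A)
colSums-conj F d A = begin
    map (colSum F A) (oneTo (F ! 0))
  ≡⟨ map-oneTo (colSum F A) (F ! 0) ⟩
    applyUpTo (colSum F A ∘ suc) (F ! 0)
  ≡⟨ applyUpTo-cong (F ! 0) (λ k _ → cong (λ l → sum (map (λ i → A i (suc k)) l)) (rowsOfColumn F d k)) ⟩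
    applyUpTo (rowSum (conj F) (reflectFilling A) ∘ suc) (F ! 0)
  ≡⟨ sym (map-oneTo (rowSum (conj F) (reflectFilling A)) (F ! 0)) ⟩
    map (rowSum (conj F) (reflectFilling A)) (oneTo (F ! 0))
  ≡⟨ cong (λ n → map (rowSum (conj F) (reflectFilling A)) (oneTo n)) (sym (length-conj F)) ⟩
    rowSums (conj F) (reflectFilling A)
  ∎
  where open ≡-Reasoning

-- Reversing an oscillating tableau

reverse-∷-∷ : ∀ {A : Set} (x y : A) T → reverse (x ∷ y ∷ T) ≡ reverse T ++ y ∷ x ∷ []
reverse-∷-∷ x y T = trans (unfold-reverse x (y ∷ T)) (trans (cong (_∷ʳ x) (unfold-reverse y T)) (∷ʳ-++ (reverse T) y (x ∷ [])))

plusIncrement : Sign → List ℕ → List ℕ → List ℕ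
plusIncrement plus  λ′ μ = size μ ∸ size λ′ ∷ []
plusIncrement minus _  _ = []

wtPlus-∷ʳ : ∀ u V s λ′ μ → length V ≡ length u →
  wtPlus (u ∷ʳ s) (V ++ λ′ ∷ μ ∷ []) ≡ wtPlus u (V ∷ʳ λ′) ++ plusIncrement s λ′ μ
wtPlus-∷ʳ []                (_ ∷ _)      s λ′ μ ()
wtPlus-∷ʳ (_ ∷ _)           []           s λ′ μ ()
wtPlus-∷ʳ (_ ∷ [])          (_ ∷ _ ∷ _)  s λ′ μ ()
wtPlus-∷ʳ (_ ∷ _ ∷ _)       (_ ∷ [])     s λ′ μ ()
wtPlus-∷ʳ []                []           plus  λ′ μ _ = refl
wtPlus-∷ʳ []                []           minus λ′ μ _ = refl
wtPlus-∷ʳ (plus  ∷ [])      (_ ∷ [])     s λ′ μ _ = cong (_ ∷_) (wtPlus-∷ʳ [] [] s λ′ μ refl)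
wtPlus-∷ʳ (minus ∷ [])      (_ ∷ [])     s λ′ μ _ = wtPlus-∷ʳ [] [] s λ′ μ refl
wtPlus-∷ʳ (plus  ∷ t ∷ u)   (_ ∷ v ∷ V)  s λ′ μ eq = cong (_ ∷_) (wtPlus-∷ʳ (t ∷ u) (v ∷ V) s λ′ μ (suc-injective eq))
wtPlus-∷ʳ (minus ∷ t ∷ u)   (_ ∷ v ∷ V)  s λ′ μ eq = wtPlus-∷ʳ (t ∷ u) (v ∷ V) s λ′ μ (suc-injective eq)

length-dualWord : ∀ w → length (dualWord w) ≡ length w
length-dualWord w = trans (length-reverse (map swap w)) (length-map swap w)

wtPlus-dualWord : ∀ w x T → length T ≡ length w → wtPlus (dualWord w) (reverse (x ∷ T)) ≡ wtMinus w (x ∷ T)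
wtPlus-dualWord []      x []      _  = refl
wtPlus-dualWord (s ∷ w) x (y ∷ T) eq = begin
    wtPlus (dualWord (s ∷ w)) (reverse (x ∷ y ∷ T))
  ≡⟨ cong₂ wtPlus (dualWord-∷ s w) (reverse-∷-∷ x y T) ⟩
    wtPlus (dualWord w ∷ʳ swap s) (reverse T ++ y ∷ x ∷ [])
  ≡⟨ wtPlus-∷ʳ (dualWord w) (reverse T) (swap s) y x
       (trans (length-reverse T) (trans (suc-injective eq) (sym (length-dualWord w)))) ⟩
    wtPlus (dualWord w) (reverse T ∷ʳ y) ++ plusIncrement (swap s) y x
  ≡⟨ cong (λ R → wtPlus (dualWord w) R ++ plusIncrement (swap s) y x) (sym (unfold-reverse y T)) ⟩
    wtPlus (dualWord w) (reverse (y ∷ T)) ++ plusIncrement (swap s) y x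
  ≡⟨ cong (_++ plusIncrement (swap s) y x) (wtPlus-dualWord w y T (suc-injective eq)) ⟩
    reverse (wtMinusFwd w (y ∷ T)) ++ plusIncrement (swap s) y x
  ≡⟨ last-increment s ⟩
    reverse (wtMinusFwd (s ∷ w) (x ∷ y ∷ T))
  ∎
  where
  open ≡-Reasoning
  last-increment : ∀ s → reverse (wtMinusFwd w (y ∷ T)) ++ plusIncrement (swap s) y x ≡
                         reverse (wtMinusFwd (s ∷ w) (x ∷ y ∷ T))
  last-increment plus  = ++-identityʳ _
  last-increment minus = sym (unfold-reverse _ (wtMinusFwd w (y ∷ T)))

-- Steps with an arbitrary final partition, so that reversal can be proved by induction.
StepsTo : List Sign → List ℕ → List (List ℕ) → List ℕ → Set
StepsTo []      λ′ []      ω = λ′ ≡ ω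
StepsTo []      _  (_ ∷ _) _ = ⊥
StepsTo (_ ∷ _) _  []      _ = ⊥
StepsTo (s ∷ w) λ′ (μ ∷ T) ω = Step s λ′ μ × StepsTo w μ T ω

steps⇒stepsTo : ∀ w λ′ T → Steps w λ′ T → StepsTo w λ′ T []
steps⇒stepsTo []      _ []      λ′≡∅        = λ′≡∅
steps⇒stepsTo (s ∷ w) _ (μ ∷ T) (step , st) = step , steps⇒stepsTo w μ T st

stepsTo⇒steps : ∀ w λ′ T → StepsTo w λ′ T [] → Steps w λ′ T
stepsTo⇒steps []      _ []      λ′≡∅        = λ′≡∅
stepsTo⇒steps (s ∷ w) _ (μ ∷ T) (step , st) = step , stepsTo⇒steps w μ T st

steps-length : ∀ w λ′ T → Steps w λ′ T → length T ≡ length w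
steps-length []      _ []      _        = refl
steps-length (_ ∷ w) _ (μ ∷ T) (_ , st) = cong suc (steps-length w μ T st)

stepsTo-∷ʳ : ∀ u λ′ V ω s ψ → StepsTo u λ′ V ω → Step s ω ψ → StepsTo (u ∷ʳ s) λ′ (V ∷ʳ ψ) ψ
stepsTo-∷ʳ []      _ []      _ s ψ refl        step = step , refl
stepsTo-∷ʳ (t ∷ u) _ (μ ∷ V) ω s ψ (step′ , st) step = step′ , stepsTo-∷ʳ u μ V ω s ψ st step

step-swap : ∀ s λ′ μ → Step s λ′ μ → Step (swap s) μ λ′
step-swap plus  _ _ step = step
step-swap minus _ _ step = step

stepsTo-reverse : ∀ w λ′ T ω → StepsTo w λ′ T ω →
  Σ[ R ∈ List (List ℕ) ] reverse (λ′ ∷ T) ≡ ω ∷ R × StepsTo (dualWord w) ω R λ′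
stepsTo-reverse []      λ′ []      ω refl = [] , refl , refl
stepsTo-reverse (s ∷ w) λ′ (μ ∷ T) ω (step , st) =
  let R , rev≡ , st′ = stepsTo-reverse w μ T ω st in
  R ∷ʳ λ′ ,
  trans (unfold-reverse λ′ (μ ∷ T)) (cong (_∷ʳ λ′) rev≡) ,
  subst (λ u → StepsTo u ω (R ∷ʳ λ′) λ′) (sym (dualWord-∷ s w))
    (stepsTo-∷ʳ (dualWord w) ω R μ (swap s) λ′ st′ (step-swap s λ′ μ step))

oscillating-reverse : ∀ w T → Oscillating w T → Oscillating (dualWord w) (reverse T)
oscillating-reverse w (λ′ ∷ T) (refl , st) with stepsTo-reverse w [] T [] (steps⇒stepsTo w [] T st)
... | R , rev≡ , st′ = subst (Oscillating (dualWord w)) (sym rev≡) (refl , stepsTo⇒steps (dualWord w) [] R st′)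

all-reverse : ∀ {P : List ℕ → Set} T → All P T → All P (reverse T)
all-reverse []      []       = []
all-reverse (x ∷ T) (px ∷ pT) = subst (All _) (sym (unfold-reverse x T)) (++⁺ (all-reverse T pT) (px ∷ []))

-- The filling is determined by the boundary

map-≡-∈ : ∀ {A B : Set} {f g : A → B} {l x} → map f l ≡ map g l → x ∈ l → f x ≡ g x
map-≡-∈ {l = _ ∷ _} eq (here refl) = ∷-injectiveˡ eq
map-≡-∈ {l = _ ∷ _} eq (there x∈) = map-≡-∈ (∷-injectiveʳ eq) x∈

∈-boundaryFrom : ∀ G y k x → k < length G → G ! suc k ≤ x → x ≤ G ! k →
  (x , suc (y + k)) ∈ boundaryFrom (suc y) G
∈-boundaryFrom (a ∷ rest) y (suc k) x (s<s k<ℓ) lo hi = ∈-++⁺ʳ _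
  (subst (λ z → (x , suc z) ∈ boundaryFrom (suc (suc y)) rest) (sym (+-suc y k)) (∈-boundaryFrom rest (suc y) k x k<ℓ lo hi))
∈-boundaryFrom (a ∷ rest) y zero    x _          lo hi with x ≟ a
... | yes refl = here (cong (x ,_) (cong suc (+-identityʳ y)))
... | no x≢a   = ∈-++⁺ˡ (there (subst (_∈ map f (upTo (a ∸ head0 rest))) (cong₂ _,_ a∸t≡x (cong suc (sym (+-identityʳ y))))
                   (∈-map⁺ f (∈-upTo⁺ t<n))))
  where
  f : ℕ → Point
  f t = a ∸ suc t , suc y
  x<a : x < a
  x<a = ≤∧≢⇒< hi x≢a
  t : ℕ
  t = a ∸ suc x
  a∸t≡x : a ∸ suc t ≡ x
  a∸t≡x = trans (sym (pred[m∸n]≡m∸[1+n] a t)) (cong pred (m∸[m∸n]≡n x<a))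
  t<n : t < a ∸ head0 rest
  t<n = ∸-monoʳ-< (s≤s (subst (_≤ x) (!-0 rest) lo)) x<a

∈-boundaryPoints : ∀ G x y → LatticePt G x y → ¬ (suc x ≤ G ! y) → (x , y) ∈ boundaryPoints G
∈-boundaryPoints G x zero    (_ , x≤)     x≮ = here (cong (_, 0) (≤-antisym x≤ (≮⇒≥ x≮)))
∈-boundaryPoints G x (suc y) (y<ℓ , x≤)  x≮ = there (∈-boundaryFrom G 0 y x y<ℓ (≮⇒≥ x≮) x≤)

!-≤-!-pred : ∀ G → Descending G → ∀ y → G ! y ≤ G ! pred y
!-≤-!-pred G d zero    = ≤-refl
!-≤-!-pred G d (suc y) = !-suc-≤ G d y

module Uniqueness {R : LocalRule} (wb : WellBehaved R) {G : List ℕ} (d : Descending G)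
  {A₁ A₂ : ℕ → ℕ → ℕ} {P₁ P₂ : ℕ → ℕ → List ℕ} (g₁ : IsGrowth R G A₁ P₁) (g₂ : IsGrowth R G A₂ P₂)
  (same-boundary : map (at P₁) (boundaryPoints G) ≡ map (at P₂) (boundaryPoints G)) where

  transport : ∀ {m κ μ μ′ ν ν′ ρ ρ′} → μ ≡ μ′ → ν ≡ ν′ → ρ ≡ ρ′ → R m κ μ ν ρ → R m κ μ′ ν′ ρ′
  transport refl refl refl r = r

  cell-agree : ∀ x y → suc x ≤ G ! y →
    P₁ x (suc y) ≡ P₂ x (suc y) → P₁ (suc x) y ≡ P₂ (suc x) y → P₁ (suc x) (suc y) ≡ P₂ (suc x) (suc y) →
    A₁ (suc y) (suc x) ≡ A₂ (suc y) (suc x) × P₁ x y ≡ P₂ x y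
  cell-agree x y x<G!y μ≡ ν≡ ρ≡ = WellBehaved.backward-unique wb (IsGrowth.local g₁ (suc y) (suc x) cell)
    (transport (sym μ≡) (sym ν≡) (sym ρ≡) (IsGrowth.local g₂ (suc y) (suc x) cell))
    where
    cell : Cell G (suc y) (suc x)
    cell = s≤s z≤n , s≤s z≤n , x<G!y

  N : ℕ
  N = sum G + length G

  latticePt-bound : ∀ x y → LatticePt G x y → x + y ≤ N
  latticePt-bound x y (y≤ , x≤) = +-mono-≤ (≤-trans x≤ (!-≤-sum G (pred y))) y≤

  -- Induction on  N − (x + y): the corners of the cell at (x , y) lie further from the origin.
  mutual
    agree-at : ∀ k x y → LatticePt G x y → N ≤ x + y + k → P₁ x y ≡ P₂ x y
    agree-at k x y pt bound with suc x ≤? G ! y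
    ... | no  x≮  = map-≡-∈ same-boundary (∈-boundaryPoints G x y pt x≮)
    ... | yes x<G!y = proj₂ (interior k x y pt bound x<G!y)

    interior : ∀ k x y → LatticePt G x y → N ≤ x + y + k → suc x ≤ G ! y →
      A₁ (suc y) (suc x) ≡ A₂ (suc y) (suc x) × P₁ x y ≡ P₂ x y
    interior zero    x y pt bound x<G!y = contradiction
      (≤-trans bound (≤-reflexive (+-identityʳ (x + y))))
      (<⇒≱ (≤-trans (s≤s (+-monoʳ-≤ x (n≤1+n y))) (latticePt-bound (suc x) (suc y) (y<ℓ , x<G!y))))
      where
      y<ℓ : y < length G
      y<ℓ = !-positive⇒<length G y (≤-trans (s≤s z≤n) x<G!y)
    interior (suc k) x y (y≤ , _) bound x<G!y = cell-agree x y x<G!y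
      (agree-at k x (suc y) (y<ℓ , ≤-trans (n≤1+n x) x<G!y) up)
      (agree-at k (suc x) y (y≤ , ≤-trans x<G!y (!-≤-!-pred G d y)) right)
      (agree-at k (suc x) (suc y) (y<ℓ , x<G!y) (≤-trans up (n≤1+n _)))
      where
      y<ℓ : y < length G
      y<ℓ = !-positive⇒<length G y (≤-trans (s≤s z≤n) x<G!y)
      shift-up : ∀ x y k → x + y + suc k ≡ x + suc y + k
      shift-up = solve-∀
      shift-right : ∀ x y k → x + y + suc k ≡ suc x + y + k
      shift-right = solve-∀
      up : N ≤ x + suc y + k
      up = ≤-trans bound (≤-reflexive (shift-up x y k))
      right : N ≤ suc x + y + k
      right = ≤-trans bound (≤-reflexive (shift-right x y k))

  fillings-agree : ∀ i j → Cell G i j → A₁ i j ≡ A₂ i j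
  fillings-agree (suc y) (suc x) (_ , _ , x<G!y) = proj₁ (interior N x y pt (m≤n+m N (x + y)) x<G!y)
    where
    pt : LatticePt G x y
    pt = ≤-trans (n≤1+n y) (!-positive⇒<length G y (≤-trans (s≤s z≤n) x<G!y)) ,
         ≤-trans (n≤1+n x) (≤-trans x<G!y (!-≤-!-pred G d y))

wtPlus-reverse : ∀ w T → Oscillating w T → wtPlus (dualWord w) (reverse T) ≡ wtMinus w T
wtPlus-reverse w (λ′ ∷ T) (_ , st) = wtPlus-dualWord w λ′ T (steps-length w λ′ T st)

reverse-oscillating-with : ∀ {P : List ℕ → Set} {w T} →
  Oscillating w T × All P T → Oscillating (dualWord w) (reverse T) × All P (reverse T)
reverse-oscillating-with {w = w} {T} (osc , all) = oscillating-reverse w T osc , all-reverse T all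

proposition3p4-for : ∀ {R Valid} → WellBehaved R →
  (∀ {w T} → Valid w T → Oscillating w T) →
  (∀ {w T} → Valid w T → Valid (dualWord w) (reverse T)) →
  Prop34Claim R Valid
proposition3p4-for {R} {Valid} wb oscillating valid-reverse F (linked , F⁺) T valid A P growth carries =
  (Rows.rowSums-wtPlus wb growth d T carries , columns) ,
  word-conj F d F⁺ , valid-reverse valid , growthᵗ , carriesᵗ ,
  λ A′ P′ growth′ carries′ →
    Uniqueness.fillings-agree wb (conj-descending F d) growth′ growthᵗ (trans carries′ (sym carriesᵗ))
  where
  open ≡-Reasoning
  d : Descending F
  d = linked⇒descending F linked
  growthᵗ : IsGrowth R (conj F) (reflectFilling A) (reflectPts P)
  growthᵗ = reflect-growth wb F d A P growth
  carriesᵗ : Carries (conj F) (reflectPts P) (reverse T)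
  carriesᵗ = carries-conj F d F⁺ P T carries
  columns : colSums F A ≡ wtMinus (word F) T
  columns = begin
      colSums F A
    ≡⟨ colSums-conj F d A ⟩
      rowSums (conj F) (reflectFilling A)
    ≡⟨ Rows.rowSums-wtPlus wb growthᵗ (conj-descending F d) (reverse T) carriesᵗ ⟩
      wtPlus (word (conj F)) (reverse T)
    ≡⟨ cong (λ w → wtPlus w (reverse T)) (word-conj F d F⁺) ⟩
      wtPlus (dualWord (word F)) (reverse T)
    ≡⟨ wtPlus-reverse (word F) T (oscillating valid) ⟩
      wtMinus (word F) T
    ∎

proposition3p4 : (∀ (d : _) → 1 ≤ d → Prop34Claim (dRSKRule d) (DSemistandard d))
    × Prop34Claim RSKRule Semistandard
proposition3p4 = dRSK , proposition3p4-for rsk-wellBehaved proj₁ reverse-oscillating-with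
  where
  dRSK : ∀ d → 1 ≤ d → Prop34Claim (dRSKRule d) (DSemistandard d)
  dRSK (suc d) _ = proposition3p4-for (drsk-wellBehaved d) proj₁ reverse-oscillating-with
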